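{- Let $v,w$ be MacLane pseudo-valuations with $v_0<w\le v$, and let $[v_0,v_1(\phi_1)=\lambda_1,\dots,v_n(\phi_n)=\lambda_n]$ be a minimal MacLane chain for $v$. Then there exists $m\le n$ such that $w=[v_{m-1},w(\phi_m)=\lambda]$ for some $\lambda$ with $v_{m-1}(\phi_m)<\lambda\le\lambda_m$.
   Context: $K$ complete discretely valued field, normalised valuation $v_K$, ring of integers $O_K$. Pseudo-valuations on $K[x]$ (maps to $\mathbb Q\cup\{\infty\}$ with $v(ab)=v(a)+v(b)$, $v(a+b)\ge\min$) extending $v_K$ with $v(x)\ge0$ are ordered by $v\le w$ iff $v(g)\le w(g)$ for all $g$; $v<w$ means $v\le w$, $v\ne w$. Gauss valuation $v_0(\sum a_ix^i)=\min v_K(a_i)$. For a valuation $v$: $g\sim_vh$ iff $v(g-h)>v(g)$; $h\mid_vg$ iff $g\sim_vqh$ for some $q$; a key polynomial over $v$ is monic, $v$-irreducible ($\phi\mid_vab\Rightarrow\phi\mid_va$ or $\phi\mid_vb$) and $v$-minimal ($\phi\mid_va\Rightarrow\deg a\ge\deg\phi$). For $\lambda\in\mathbb Q\cup\{\infty\}$, $\lambda>v(\phi)$, the augmentation $[v,w(\phi)=\lambda]$ is $w(\sum a_i\phi^i)=\min(v(a_i)+i\lambda)$, $\deg a_i<\deg\phi$. A MacLane pseudo-valuation is one reached from $v_0$ by an augmentation chain $[v_0,v_1(\phi_1)=\lambda_1,\dots,v_n(\phi_n)=\lambda_n]$ (each $v_i=[v_{i-1},v_i(\phi_i)=\lambda_i]$,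 $v_n=v$). The chain is a MacLane chain if $\phi_{i+1}\not\sim_{v_i}\phi_i$ for all $i$, and minimal if $\deg\phi_{i+1}>\deg\phi_i$ for all $i$. -}

module Defs where

open import Level using (0ℓ)
open import Algebra.Bundles using (CommutativeRing)
open import Data.Nat as ℕ using (ℕ; zero; suc)
open import Data.Integer using (ℤ)
open import Data.Rational as ℚ using (ℚ; 0ℚ; 1ℚ)
open import Data.List using (List; []; _∷_)
open import Data.Fin using (Fin; inject₁; fromℕ) renaming (suc to fsuc; zero to fzero)
open import Data.Product using (Σ; ∃; ∃-syntax; _×_; _,_)
open import Data.Sum using (_⊎_)
open import Relation.Nullary using (¬_)
open import Relation.Binary.PropositionalEquality using (_≡_)
import Data.Bool
import Data.Unit
import Data.Maybe
import Data.Fin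

data ℚ∞ : Set where
  fin : ℚ → ℚ∞
  ∞   : ℚ∞

infix 4 _≤∞_ _<∞_
data _≤∞_ : ℚ∞ → ℚ∞ → Set where
  fin≤fin : ∀ {p q} → p ℚ.≤ q → fin p ≤∞ fin q
  _≤∞∞    : ∀ x → x ≤∞ ∞

data _<∞_ : ℚ∞ → ℚ∞ → Set where
  fin<fin : ∀ {p q} → p ℚ.< q → fin p <∞ fin q
  fin<∞   : ∀ {p} → fin p <∞ ∞

infixl 6 _+∞_
_+∞_ : ℚ∞ → ℚ∞ → ℚ∞
fin p +∞ fin q = fin (p ℚ.+ q)
fin p +∞ ∞     = ∞
∞     +∞ _     = ∞

min∞ : ℚ∞ → ℚ∞ → ℚ∞
min∞ (fin p) (fin q) = fin (p ℚ.⊓ q)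
min∞ (fin p) ∞       = fin p
min∞ ∞       y       = y

-- i · λ, with the convention 0 · λ = 0 (also for λ = ∞)
_·∞_ : ℕ → ℚ∞ → ℚ∞
zero  ·∞ _ = fin 0ℚ
suc i ·∞ l = l +∞ (i ·∞ l)

record CDVF : Set₁ where
  field
    cring : CommutativeRing 0ℓ 0ℓ
  open CommutativeRing cring public
  field
    0≉1      : ¬ (0# ≈ 1#)
    inverse  : ∀ a → ¬ (a ≈ 0#) → ∃[ b ] (a * b ≈ 1#)
    vK       : Carrier → ℚ∞
    vK-cong  : ∀ {a b} → a ≈ b → vK a ≡ vK b
    vK-∞     : ∀ a → vK a ≡ ∞ → a ≈ 0#
    vK-0     : vK 0# ≡ ∞
    vK-*     : ∀ a b → vK (a * b) ≡ vK a +∞ vK b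
    vK-+     : ∀ a b → min∞ (vK a) (vK b) ≤∞ vK (a + b)
    vK-discrete : ∀ a → vK a ≡ ∞ ⊎ ∃[ z ] (vK a ≡ fin (z ℚ./ 1))
    uniformiser : ∃[ π ] (vK π ≡ fin 1ℚ)
    complete : (s : ℕ → Carrier) →
      (∀ (N : ℚ) → ∃[ M ] (∀ i j → M ℕ.≤ i → M ℕ.≤ j → fin N ≤∞ vK (s i - s j))) →
      ∃[ L ] (∀ (N : ℚ) → ∃[ M ] (∀ i → M ℕ.≤ i → fin N ≤∞ vK (s i - L)))

-- Polynomials over K, coefficient lists (constant term first)

module Over (F : CDVF) where
  open CDVF F

  Poly : Set
  Poly = List Carrier

  -- zero test via the valuation (vK a ≡ ∞ iff a ≈ 0)
  isZero? : Carrier → Data.Bool.Bool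
  isZero? a with vK a
  ... | ∞     = Data.Bool.true
  ... | fin _ = Data.Bool.false

  infix 4 _≈P_
  _≈P_ : Poly → Poly → Set
  [] ≈P [] = Data.Unit.⊤
  [] ≈P (b ∷ bs) = (b ≈ 0#) × ([] ≈P bs)
  (a ∷ as) ≈P [] = (a ≈ 0#) × (as ≈P [])
  (a ∷ as) ≈P (b ∷ bs) = (a ≈ b) × (as ≈P bs)

  const : Carrier → Poly
  const a = a ∷ []

  X : Poly
  X = 0# ∷ 1# ∷ []

  infixl 6 _+P_ _-P_
  infixl 7 _*P_
  _+P_ : Poly → Poly → Poly
  [] +P q = q
  (a ∷ p) +P [] = a ∷ p
  (a ∷ p) +P (b ∷ q) = (a + b) ∷ (p +P q)

  scale : Carrier → Poly → Poly
  scale c [] = []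
  scale c (a ∷ p) = (c * a) ∷ scale c p

  _*P_ : Poly → Poly → Poly
  [] *P q = []
  (a ∷ p) *P q = scale a q +P (0# ∷ (p *P q))

  negP : Poly → Poly
  negP = scale (- 1#)

  _-P_ : Poly → Poly → Poly
  p -P q = p +P negP q

  -- degree (the zero polynomial has degree 0 by convention) and
  -- leading coefficient (0# for the zero polynomial)
  degLc : Poly → Data.Maybe.Maybe (ℕ × Carrier)
  degLc [] = Data.Maybe.nothing
  degLc (a ∷ p) with degLc p
  ... | Data.Maybe.just (d , c) = Data.Maybe.just (suc d , c)
  ... | Data.Maybe.nothing with isZero? a
  ...   | Data.Bool.true  = Data.Maybe.nothing
  ...   | Data.Bool.false = Data.Maybe.just (0 , a)

  deg : Poly → ℕ
  deg p with degLc p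
  ... | Data.Maybe.just (d , _) = d
  ... | Data.Maybe.nothing = 0

  lc : Poly → Carrier
  lc p with degLc p
  ... | Data.Maybe.just (_ , c) = c
  ... | Data.Maybe.nothing = 0#

  Monic : Poly → Set
  Monic φ = lc φ ≈ 1#

  PV : Set
  PV = Poly → ℚ∞

  record IsPseudoValuation (v : PV) : Set where
    field
      cong    : ∀ {f g} → f ≈P g → v f ≡ v g
      mult    : ∀ f g → v (f *P g) ≡ v f +∞ v g
      ultra   : ∀ f g → min∞ (v f) (v g) ≤∞ v (f +P g)
      extends : ∀ a → v (const a) ≡ vK a
      x≥0     : fin 0ℚ ≤∞ v X

  IsValuation : PV → Set
  IsValuation v = IsPseudoValuation v × (∀ f → v f ≡ ∞ → f ≈P [])

  infix 4 _≤V_ _<V_ _≡V_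
  _≤V_ : PV → PV → Set
  v ≤V w = ∀ g → v g ≤∞ w g

  _≡V_ : PV → PV → Set
  v ≡V w = ∀ g → v g ≡ w g

  _<V_ : PV → PV → Set
  v <V w = (v ≤V w) × ¬ (v ≡V w)

  v₀ : PV
  v₀ [] = ∞
  v₀ (a ∷ p) = min∞ (vK a) (v₀ p)

  _∼[_]_ : Poly → PV → Poly → Set
  g ∼[ v ] h = v g <∞ v (g -P h)

  _∣[_]_ : Poly → PV → Poly → Set
  h ∣[ v ] g = ∃[ q ] (g ∼[ v ] (q *P h))

  record IsKeyPolynomial (v : PV) (φ : Poly) : Set where
    field
      monic       : Monic φ
      irreducible : ∀ a b → φ ∣[ v ] (a *P b) → (φ ∣[ v ] a) ⊎ (φ ∣[ v ] b)
      minimal     : ∀ a → φ ∣[ v ] a → deg φ ℕ.≤ deg a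

  φsum : Poly → List Poly → Poly
  φsum φ [] = []
  φsum φ (a ∷ as) = a +P (φ *P φsum φ as)

  augVal : PV → ℚ∞ → ℕ → List Poly → ℚ∞
  augVal v l k [] = ∞
  augVal v l k (a ∷ as) = min∞ (v a +∞ (k ·∞ l)) (augVal v l (suc k) as)

  AllDegLt : ℕ → List Poly → Set
  AllDegLt d [] = Data.Unit.⊤
  AllDegLt d (a ∷ as) = (deg a ℕ.< d) × AllDegLt d as

  -- w = [v, w(φ) = λ]: w is given on every f by the φ-adic expansion
  -- f = Σ a_i φ^i (deg a_i < deg φ) as  min_i (v(a_i) + i λ)
  IsAugmentation : PV → Poly → ℚ∞ → PV → Set
  IsAugmentation v φ l w =
    ∀ f (as : List Poly) → AllDegLt (deg φ) as → f ≈P φsum φ as → w f ≡ augVal v l 0 as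

  -- augmentation chains [v₀, v₁(φ₁)=λ₁, …, vₙ(φₙ)=λₙ]
  -- vs i = v_i (i = 0 … n); φs i = φ_{i+1}, λs i = λ_{i+1} (i = 0 … n-1)

  record Chain (n : ℕ) (v : PV) : Set where
    field
      vs   : Fin (suc n) → PV
      φs   : Fin n → Poly
      λs   : Fin n → ℚ∞
      start : vs fzero ≡V v₀
      end   : vs (fromℕ n) ≡V v
      base-valuation : ∀ i → IsValuation (vs (inject₁ i))
      key  : ∀ i → IsKeyPolynomial (vs (inject₁ i)) (φs i)
      λ>   : ∀ i → vs (inject₁ i) (φs i) <∞ λs i
      aug  : ∀ i → IsAugmentation (vs (inject₁ i)) (φs i) (λs i) (vs (fsuc i))

  open Chain public

  IsMacLaneChain : ∀ {n v} → Chain n v → Set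
  IsMacLaneChain {n} c = ∀ (i : Fin n) (j : Fin n) → Data.Fin.toℕ j ≡ suc (Data.Fin.toℕ i) →
    ¬ (φs c j ∼[ vs c (fsuc i) ] φs c i)

  IsMinimalChain : ∀ {n v} → Chain n v → Set
  IsMinimalChain {n} c = ∀ (i : Fin n) (j : Fin n) → Data.Fin.toℕ j ≡ suc (Data.Fin.toℕ i) →
    deg (φs c i) ℕ.< deg (φs c j)

  IsMacLanePV : PV → Set
  IsMacLanePV v = IsPseudoValuation v × ∃[ n ] Chain n v

-- Write vᵢ₊₁ = [vᵢ, vᵢ₊₁(φᵢ) = λᵢ] for the steps of the chain.  Minimality makes deg φᵢ strictly
-- increasing, so v agrees with vᵢ on polynomials of degree < deg φᵢ and v(φᵢ) = λᵢ.  Climb the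
-- chain as long as vᵢ ≤ w.  Since w ≤ v we have w(φᵢ) ≤ λᵢ.  If w(φᵢ) = λᵢ, comparing φᵢ-adic
-- expansions gives vᵢ₊₁ ≤ w.  If w(φᵢ) < λᵢ, then in each expansion the φᵢ-part is strictly
-- dominated for v, which forces w = [vᵢ, w(φᵢ)]; if moreover w(φᵢ) = vᵢ(φᵢ), then w = vᵢ because
-- φᵢ is a key polynomial for vᵢ, and vᵢ = [vᵢ₋₁, λᵢ₋₁] (i = 0 is excluded by v₀ < w).  If the
-- climb reaches the end of the chain, then w = v = [vₙ₋₁, λₙ₋₁].

module Submission where

open import Defs
open import Level using (0ℓ)
open import Data.Nat using (ℕ; zero; suc; pred; _<_; _≤_; _<?_; z≤n; s≤s; >-nonZero)
import Data.Nat.Properties as ℕ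
open import Data.Fin as Fin using (Fin; inject₁; fromℕ; toℕ) renaming (zero to fzero; suc to fsuc)
open import Data.Fin.Properties using (toℕ-inject₁)
open import Data.Fin.Induction using (<-weakInduction-startingFrom; <-weakInduction; >-weakInduction)
open import Data.Rational as ℚ using (0ℚ)
import Data.Rational.Properties as ℚ
open import Data.List using (List; []; _∷_)
open import Data.List.Relation.Unary.All using (All; []; _∷_)
open import Data.Maybe using (Maybe; just; nothing)
open import Data.Bool using (true; false)
open import Data.Product using (∃-syntax; _×_; _,_; proj₁; proj₂)
open import Data.Sum as Sum using (_⊎_; inj₁; inj₂; [_,_])
open import Data.Unit using (tt)
open import Data.Empty using (⊥-elim)
open import Function using (_∘_; id)
open import Relation.Nullary using (¬_; contradiction; yes; no)
open import Relation.Binary.Core using (_⇒_; _Preserves_⟶_)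
open import Relation.Binary.Definitions
  using (Reflexive; Transitive; Antisymmetric; Asymmetric; Total; Irreflexive; Trichotomous; tri<; tri≈; tri>)
open import Relation.Binary.Bundles using (Setoid; TotalPreorder)
open import Relation.Binary.Structures using (IsPreorder)
import Relation.Binary.PropositionalEquality as ≡
open ≡ using (_≡_; _≢_)
import Relation.Binary.Reasoning.Setoid as SetoidReasoning
open import Algebra.Bundles using (CommutativeRing)
import Algebra.Consequences.Setoid as Consequences
open import Algebra.Construct.NaturalChoice.Base using (MinOperator)
import Algebra.Construct.NaturalChoice.MinOp as MinOp
open import Algebra.Properties.Ring ℚ.+-*-ring using (x+x≈x⇒x≈0)

≤∞-refl : Reflexive _≤∞_
≤∞-refl {fin p} = fin≤fin ℚ.≤-refl
≤∞-refl {∞}     = ∞ ≤∞∞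

≤∞-reflexive : _≡_ ⇒ _≤∞_
≤∞-reflexive ≡.refl = ≤∞-refl

≤∞-trans : Transitive _≤∞_
≤∞-trans (fin≤fin p≤q) (fin≤fin q≤r) = fin≤fin (ℚ.≤-trans p≤q q≤r)
≤∞-trans _             (_ ≤∞∞)       = _ ≤∞∞

≤∞-antisym : Antisymmetric _≡_ _≤∞_
≤∞-antisym (fin≤fin p≤q) (fin≤fin q≤p) = ≡.cong fin (ℚ.≤-antisym p≤q q≤p)
≤∞-antisym (∞ ≤∞∞)       _             = ≡.refl

≤∞-total : Total _≤∞_
≤∞-total (fin p) (fin q) = Sum.map fin≤fin fin≤fin (ℚ.≤-total p q)
≤∞-total x       ∞       = inj₁ (x ≤∞∞)
≤∞-total ∞       y       = inj₂ (y ≤∞∞)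

≤∞-isPreorder : IsPreorder _≡_ _≤∞_
≤∞-isPreorder = record { isEquivalence = ≡.isEquivalence ; reflexive = ≤∞-reflexive ; trans = ≤∞-trans }

≤∞-totalPreorder : TotalPreorder 0ℓ 0ℓ 0ℓ
≤∞-totalPreorder = record { isTotalPreorder = record { isPreorder = ≤∞-isPreorder ; total = ≤∞-total } }

x≤y⇒min∞≡x : ∀ {x y} → x ≤∞ y → min∞ x y ≡ x
x≤y⇒min∞≡x (fin≤fin p≤q)  = ≡.cong fin (ℚ.p≤q⇒p⊓q≡p p≤q)
x≤y⇒min∞≡x {fin p} (_ ≤∞∞) = ≡.refl
x≤y⇒min∞≡x {∞}     (_ ≤∞∞) = ≡.refl

x≥y⇒min∞≡y : ∀ {x y} → y ≤∞ x → min∞ x y ≡ y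
x≥y⇒min∞≡y (fin≤fin q≤p) = ≡.cong fin (ℚ.p≥q⇒p⊓q≡q q≤p)
x≥y⇒min∞≡y {∞} (_ ≤∞∞)   = ≡.refl

min∞-operator : MinOperator ≤∞-totalPreorder
min∞-operator = record
  { _⊓_ = min∞ ; x≤y⇒x⊓y≈x = x≤y⇒min∞≡x ; x≥y⇒x⊓y≈y = x≥y⇒min∞≡y }

open MinOp min∞-operator public
  using (⊓-mono-≤; mono-≤-distrib-⊓)

min∞-identityʳ : ∀ x → min∞ x ∞ ≡ x
min∞-identityʳ (fin p) = ≡.refl
min∞-identityʳ ∞       = ≡.refl

<⇒≤∞ : _<∞_ ⇒ _≤∞_
<⇒≤∞ (fin<fin p<q) = fin≤fin (ℚ.<⇒≤ p<q)
<⇒≤∞ fin<∞         = _ ≤∞∞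

<-≤∞-trans : ∀ {x y z} → x <∞ y → y ≤∞ z → x <∞ z
<-≤∞-trans (fin<fin p<q) (fin≤fin q≤r) = fin<fin (ℚ.<-≤-trans p<q q≤r)
<-≤∞-trans (fin<fin _)   (_ ≤∞∞)       = fin<∞
<-≤∞-trans fin<∞         (_ ≤∞∞)       = fin<∞

≤-<∞-trans : ∀ {x y z} → x ≤∞ y → y <∞ z → x <∞ z
≤-<∞-trans (fin≤fin p≤q) (fin<fin q<r) = fin<fin (ℚ.≤-<-trans p≤q q<r)
≤-<∞-trans (fin≤fin _)   fin<∞         = fin<∞

<∞-trans : Transitive _<∞_
<∞-trans x<y y<z = <-≤∞-trans x<y (<⇒≤∞ y<z)

<∞-irrefl : Irreflexive _≡_ _<∞_
<∞-irrefl ≡.refl (fin<fin p<p) = ℚ.<-irrefl ≡.refl p<p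

≤⇒≯∞ : ∀ {x y} → x ≤∞ y → ¬ (y <∞ x)
≤⇒≯∞ x≤y y<x = <∞-irrefl ≡.refl (≤-<∞-trans x≤y y<x)

<∞-asym : Asymmetric _<∞_
<∞-asym x<y = ≤⇒≯∞ (<⇒≤∞ x<y)

fin-injective : ∀ {p q} → fin p ≡ fin q → p ≡ q
fin-injective ≡.refl = ≡.refl

<∞-cmp : Trichotomous _≡_ _<∞_
<∞-cmp (fin p) (fin q) with ℚ.<-cmp p q
... | tri< p<q p≢q _   = tri< (fin<fin p<q) (p≢q ∘ fin-injective) (≤⇒≯∞ (<⇒≤∞ (fin<fin p<q)))
... | tri≈ _ ≡.refl _    = tri≈ (<∞-irrefl ≡.refl) ≡.refl (<∞-irrefl ≡.refl)
... | tri> _ p≢q q<p   = tri> (≤⇒≯∞ (<⇒≤∞ (fin<fin q<p))) (p≢q ∘ fin-injective) (fin<fin q<p)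
<∞-cmp (fin p) ∞ = tri< fin<∞ (λ ()) (λ ())
<∞-cmp ∞ (fin q) = tri> (λ ()) (λ ()) fin<∞
<∞-cmp ∞ ∞       = tri≈ (λ ()) ≡.refl (λ ())

≮⇒≥∞ : ∀ {x y} → ¬ (x <∞ y) → y ≤∞ x
≮⇒≥∞ {x} {y} x≮y with <∞-cmp x y
... | tri< x<y _ _ = contradiction x<y x≮y
... | tri≈ _ ≡.refl _ = ≤∞-refl
... | tri> _ _ y<x = <⇒≤∞ y<x

min∞≤-<⇒≤ : ∀ {x y t} → min∞ x y ≤∞ t → t <∞ y → x ≤∞ t
min∞≤-<⇒≤ {x} {y} {t} min≤t t<y with ≤∞-total x y
... | inj₁ x≤y = ≡.subst (_≤∞ t) (x≤y⇒min∞≡x x≤y) min≤t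
... | inj₂ y≤x = contradiction t<y (≤⇒≯∞ (≡.subst (_≤∞ t) (x≥y⇒min∞≡y y≤x) min≤t))

module ≤∞-Reasoning where
  open import Relation.Binary.Reasoning.Base.Triple
    ≤∞-isPreorder <∞-asym <∞-trans (≡.resp₂ _<∞_) <⇒≤∞ <-≤∞-trans ≤-<∞-trans
    public
    hiding (step-≈; step-≈˘; step-≈-⟩; step-≈-⟨)

+∞-identityˡ : ∀ x → fin 0ℚ +∞ x ≡ x
+∞-identityˡ (fin p) = ≡.cong fin (ℚ.+-identityˡ p)
+∞-identityˡ ∞       = ≡.refl

+∞-identityʳ : ∀ x → x +∞ fin 0ℚ ≡ x
+∞-identityʳ (fin p) = ≡.cong fin (ℚ.+-identityʳ p)
+∞-identityʳ ∞       = ≡.refl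

+∞-zeroʳ : ∀ x → x +∞ ∞ ≡ ∞
+∞-zeroʳ (fin p) = ≡.refl
+∞-zeroʳ ∞       = ≡.refl

+∞-comm : ∀ x y → x +∞ y ≡ y +∞ x
+∞-comm (fin p) (fin q) = ≡.cong fin (ℚ.+-comm p q)
+∞-comm (fin p) ∞       = ≡.refl
+∞-comm ∞       (fin q) = ≡.refl
+∞-comm ∞       ∞       = ≡.refl

+∞-assoc : ∀ x y z → (x +∞ y) +∞ z ≡ x +∞ (y +∞ z)
+∞-assoc (fin p) (fin q) (fin r) = ≡.cong fin (ℚ.+-assoc p q r)
+∞-assoc (fin p) (fin q) ∞       = ≡.refl
+∞-assoc (fin p) ∞       z       = ≡.refl
+∞-assoc ∞       y       z       = ≡.refl

+∞-mono-≤ : ∀ {x x′ y y′} → x ≤∞ x′ → y ≤∞ y′ → x +∞ y ≤∞ x′ +∞ y′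
+∞-mono-≤ (fin≤fin p≤q) (fin≤fin r≤s) = fin≤fin (ℚ.+-mono-≤ p≤q r≤s)
+∞-mono-≤ (fin≤fin _)   (_ ≤∞∞)       = _ ≤∞∞
+∞-mono-≤ (_ ≤∞∞)       _             = _ ≤∞∞

+∞-monoʳ-≤ : ∀ x → (x +∞_) Preserves _≤∞_ ⟶ _≤∞_
+∞-monoʳ-≤ x = +∞-mono-≤ (≤∞-refl {x})

+∞-mono-<-≤ : ∀ {x y q t} → x <∞ y → fin q ≤∞ t → x +∞ fin q <∞ y +∞ t
+∞-mono-<-≤ (fin<fin p<r) (fin≤fin q≤s) = fin<fin (ℚ.+-mono-<-≤ p<r q≤s)
+∞-mono-<-≤ (fin<fin _)   (_ ≤∞∞)       = fin<∞
+∞-mono-<-≤ fin<∞         _             = fin<∞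

+∞-distribˡ-min∞ : ∀ x y z → x +∞ min∞ y z ≡ min∞ (x +∞ y) (x +∞ z)
+∞-distribˡ-min∞ x = mono-≤-distrib-⊓ (≡.cong (x +∞_)) (+∞-monoʳ-≤ x)

p+p≡0⇒p≡0 : ∀ p → p ℚ.+ p ≡ 0ℚ → p ≡ 0ℚ
p+p≡0⇒p≡0 p p+p≡0 with ℚ.<-cmp p 0ℚ
... | tri< p<0 _ _ = ⊥-elim (ℚ.<-irrefl p+p≡0 (ℚ.+-mono-< p<0 p<0))
... | tri≈ _ p≡0 _ = p≡0
... | tri> _ _ p>0 = ⊥-elim (ℚ.<-irrefl (≡.sym p+p≡0) (ℚ.+-mono-< p>0 p>0))

x+∞x≡0⇒x≡0 : ∀ {x} → x +∞ x ≡ fin 0ℚ → x ≡ fin 0ℚ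
x+∞x≡0⇒x≡0 {fin p} p+p≡0 = ≡.cong fin (p+p≡0⇒p≡0 p (fin-injective p+p≡0))
x+∞x≡0⇒x≡0 {∞}     ()

module Polynomials (F : CDVF) where
  open CDVF F hiding (zero)
  open Over F
  open import Algebra.Properties.Ring ring using (-1*x≈-x)

  coef : Poly → ℕ → Carrier
  coef []      _       = 0#
  coef (a ∷ p) zero    = a
  coef (a ∷ p) (suc k) = coef p k

  -- A record rather than a function into Set, so that p and q can be inferred from p ≃ q.
  infix 4 _≃_
  record _≃_ (p q : Poly) : Set where
    constructor coeffwise
    field coef-≈ : ∀ k → coef p k ≈ coef q k
  open _≃_ public

  ≃⇒≈P : ∀ p q → p ≃ q → p ≈P q
  ≃⇒≈P []      []      _ = tt
  ≃⇒≈P []      (b ∷ q) (coeffwise e) = sym (e zero) , ≃⇒≈P [] q (coeffwise (λ k → e (suc k)))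
  ≃⇒≈P (a ∷ p) []      (coeffwise e) = e zero , ≃⇒≈P p [] (coeffwise (λ k → e (suc k)))
  ≃⇒≈P (a ∷ p) (b ∷ q) (coeffwise e) = e zero , ≃⇒≈P p q (coeffwise (λ k → e (suc k)))

  ≃-setoid : Setoid 0ℓ 0ℓ
  ≃-setoid = record
    { Carrier       = Poly
    ; _≈_           = _≃_
    ; isEquivalence = record
      { refl  = coeffwise λ _ → refl
      ; sym   = λ p≃q → coeffwise λ k → sym (coef-≈ p≃q k)
      ; trans = λ p≃q q≃r → coeffwise λ k → trans (coef-≈ p≃q k) (coef-≈ q≃r k)
      }
    }

  open Setoid ≃-setoid public using ()
    renaming (refl to ≃-refl; sym to ≃-sym; trans to ≃-trans)
  module ≃-Reasoning = SetoidReasoning ≃-setoid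
  private module K = SetoidReasoning setoid

  coef-+P : ∀ p q k → coef (p +P q) k ≈ coef p k + coef q k
  coef-+P []      q       k       = sym (+-identityˡ _)
  coef-+P (a ∷ p) []      k       = sym (+-identityʳ _)
  coef-+P (a ∷ p) (b ∷ q) zero    = refl
  coef-+P (a ∷ p) (b ∷ q) (suc k) = coef-+P p q k

  coef-scale : ∀ c p k → coef (scale c p) k ≈ c * coef p k
  coef-scale c []      k       = sym (zeroʳ c)
  coef-scale c (a ∷ p) zero    = refl
  coef-scale c (a ∷ p) (suc k) = coef-scale c p k

  ∷-cong : ∀ {a b p q} → a ≈ b → p ≃ q → (a ∷ p) ≃ (b ∷ q)
  ∷-cong a≈b p≃q = coeffwise λ where
    zero    → a≈b
    (suc k) → coef-≈ p≃q k

  +P-cong : ∀ {p p′ q q′} → p ≃ p′ → q ≃ q′ → p +P q ≃ p′ +P q′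
  +P-cong {p} {p′} {q} {q′} p≃p′ q≃q′ = coeffwise λ k → K.begin
    coef (p +P q) k         K.≈⟨ coef-+P p q k ⟩
    coef p k + coef q k     K.≈⟨ +-cong (coef-≈ p≃p′ k) (coef-≈ q≃q′ k) ⟩
    coef p′ k + coef q′ k   K.≈⟨ coef-+P p′ q′ k ⟨
    coef (p′ +P q′) k       K.∎

  +P-congˡ : ∀ p {q q′} → q ≃ q′ → p +P q ≃ p +P q′
  +P-congˡ p = +P-cong (≃-refl {p})

  +P-comm : ∀ p q → p +P q ≃ q +P p
  +P-comm p q = coeffwise λ k → K.begin
    coef (p +P q) k       K.≈⟨ coef-+P p q k ⟩
    coef p k + coef q k   K.≈⟨ +-comm _ _ ⟩
    coef q k + coef p k   K.≈⟨ coef-+P q p k ⟨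
    coef (q +P p) k       K.∎

  +P-assoc : ∀ p q r → (p +P q) +P r ≃ p +P (q +P r)
  +P-assoc p q r = coeffwise λ k → K.begin
    coef ((p +P q) +P r) k                K.≈⟨ coef-+P (p +P q) r k ⟩
    coef (p +P q) k + coef r k            K.≈⟨ +-congʳ (coef-+P p q k) ⟩
    (coef p k + coef q k) + coef r k      K.≈⟨ +-assoc _ _ _ ⟩
    coef p k + (coef q k + coef r k)      K.≈⟨ +-congˡ (coef-+P q r k) ⟨
    coef p k + coef (q +P r) k            K.≈⟨ coef-+P p (q +P r) k ⟨
    coef (p +P (q +P r)) k                K.∎

  +P-identityʳ : ∀ p → p +P [] ≃ p
  +P-identityʳ []      = ≃-refl
  +P-identityʳ (a ∷ p) = ≃-refl

  coef-negP : ∀ p k → coef (negP p) k ≈ - coef p k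
  coef-negP p k = trans (coef-scale (- 1#) p k) (-1*x≈-x _)

  negP-inverseʳ : ∀ p → p +P negP p ≃ []
  negP-inverseʳ p = coeffwise λ k → K.begin
    coef (p +P negP p) k              K.≈⟨ coef-+P p (negP p) k ⟩
    coef p k + coef (negP p) k        K.≈⟨ +-congˡ (coef-negP p k) ⟩
    coef p k + - coef p k             K.≈⟨ -‿inverseʳ _ ⟩
    0#                                K.∎

  scale-cong : ∀ {c c′ p p′} → c ≈ c′ → p ≃ p′ → scale c p ≃ scale c′ p′
  scale-cong {c} {c′} {p} {p′} c≈c′ p≃p′ = coeffwise λ k → K.begin
    coef (scale c p) k     K.≈⟨ coef-scale c p k ⟩
    c * coef p k           K.≈⟨ *-cong c≈c′ (coef-≈ p≃p′ k) ⟩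
    c′ * coef p′ k         K.≈⟨ coef-scale c′ p′ k ⟨
    coef (scale c′ p′) k   K.∎

  scale-distrib-+P : ∀ c p q → scale c (p +P q) ≃ scale c p +P scale c q
  scale-distrib-+P c p q = coeffwise λ k → K.begin
    coef (scale c (p +P q)) k                  K.≈⟨ coef-scale c (p +P q) k ⟩
    c * coef (p +P q) k                        K.≈⟨ *-congˡ (coef-+P p q k) ⟩
    c * (coef p k + coef q k)                  K.≈⟨ distribˡ _ _ _ ⟩
    c * coef p k + c * coef q k                K.≈⟨ +-cong (coef-scale c p k) (coef-scale c q k) ⟨
    coef (scale c p) k + coef (scale c q) k    K.≈⟨ coef-+P (scale c p) (scale c q) k ⟨
    coef (scale c p +P scale c q) k            K.∎

  scale-* : ∀ c d p → scale (c * d) p ≃ scale c (scale d p)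
  scale-* c d p = coeffwise λ k → K.begin
    coef (scale (c * d) p) k     K.≈⟨ coef-scale (c * d) p k ⟩
    (c * d) * coef p k           K.≈⟨ *-assoc _ _ _ ⟩
    c * (d * coef p k)           K.≈⟨ *-congˡ (coef-scale d p k) ⟨
    c * coef (scale d p) k       K.≈⟨ coef-scale c (scale d p) k ⟨
    coef (scale c (scale d p)) k K.∎

  scale-zero : ∀ {c} p → c ≈ 0# → scale c p ≃ []
  scale-zero {c} p c≈0 = coeffwise λ k → trans (coef-scale c p k) (trans (*-congʳ c≈0) (zeroˡ _))

  scale-identity : ∀ p → scale 1# p ≃ p
  scale-identity p = coeffwise λ k → trans (coef-scale 1# p k) (*-identityˡ _)

  0∷-+P : ∀ p q → 0# ∷ (p +P q) ≃ (0# ∷ p) +P (0# ∷ q)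
  0∷-+P p q = ∷-cong (sym (+-identityˡ 0#)) ≃-refl

  0∷-zero : ∀ {p} → p ≃ [] → 0# ∷ p ≃ []
  0∷-zero p≃[] = coeffwise λ where
    zero    → refl
    (suc k) → coef-≈ p≃[] k

  *P-zeroʳ : ∀ p → p *P [] ≃ []
  *P-zeroʳ []      = ≃-refl
  *P-zeroʳ (a ∷ p) = 0∷-zero (*P-zeroʳ p)

  *P-congʳ : ∀ p {q q′} → q ≃ q′ → p *P q ≃ p *P q′
  *P-congʳ []      q≃q′ = ≃-refl
  *P-congʳ (a ∷ p) q≃q′ = +P-cong (scale-cong refl q≃q′) (∷-cong refl (*P-congʳ p q≃q′))

  *P-∷ʳ : ∀ p b q → p *P (b ∷ q) ≃ scale b p +P (0# ∷ (p *P q))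
  *P-∷ʳ []      b q = ≃-sym (0∷-zero ≃-refl)
  *P-∷ʳ (a ∷ p) b q = ∷-cong (+-congʳ (*-comm a b)) (begin
    scale a q +P (p *P (b ∷ q))                      ≈⟨ +P-congˡ (scale a q) (*P-∷ʳ p b q) ⟩
    scale a q +P (scale b p +P (0# ∷ (p *P q)))      ≈⟨ +P-assoc (scale a q) _ _ ⟨
    (scale a q +P scale b p) +P (0# ∷ (p *P q))      ≈⟨ +P-cong (+P-comm (scale a q) _) ≃-refl ⟩
    (scale b p +P scale a q) +P (0# ∷ (p *P q))      ≈⟨ +P-assoc (scale b p) _ _ ⟩
    scale b p +P (scale a q +P (0# ∷ (p *P q)))      ∎)
    where open ≃-Reasoning

  *P-comm : ∀ p q → p *P q ≃ q *P p
  *P-comm []      q = ≃-sym (*P-zeroʳ q)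
  *P-comm (a ∷ p) q = ≃-trans (+P-congˡ (scale a q) (∷-cong refl (*P-comm p q))) (≃-sym (*P-∷ʳ q a p))

  *P-congˡ : ∀ {p p′} q → p ≃ p′ → p *P q ≃ p′ *P q
  *P-congˡ {p} {p′} q p≃p′ = ≃-trans (*P-comm p q) (≃-trans (*P-congʳ q p≃p′) (*P-comm q p′))

  +P-middleFour : ∀ p q r s → (p +P q) +P (r +P s) ≃ (p +P r) +P (q +P s)
  +P-middleFour = Consequences.comm∧assoc⇒middleFour ≃-setoid +P-cong +P-comm +P-assoc

  *P-distribˡ : ∀ r p q → r *P (p +P q) ≃ r *P p +P r *P q
  *P-distribˡ []      p q = ≃-refl
  *P-distribˡ (a ∷ r) p q = begin
    scale a (p +P q) +P (0# ∷ (r *P (p +P q)))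
      ≈⟨ +P-cong (scale-distrib-+P a p q) (∷-cong refl (*P-distribˡ r p q)) ⟩
    (scale a p +P scale a q) +P (0# ∷ (r *P p +P r *P q))
      ≈⟨ +P-congˡ (scale a p +P scale a q) (0∷-+P (r *P p) (r *P q)) ⟩
    (scale a p +P scale a q) +P ((0# ∷ (r *P p)) +P (0# ∷ (r *P q)))
      ≈⟨ +P-middleFour (scale a p) _ _ _ ⟩
    (scale a p +P (0# ∷ (r *P p))) +P (scale a q +P (0# ∷ (r *P q)))
      ∎
    where open ≃-Reasoning

  scale-*P : ∀ c p q → scale c p *P q ≃ scale c (p *P q)
  scale-*P c []      q = ≃-refl
  scale-*P c (a ∷ p) q = begin
    scale (c * a) q +P (0# ∷ (scale c p *P q))
      ≈⟨ +P-cong (scale-* c a q) (∷-cong (sym (zeroʳ c)) (scale-*P c p q)) ⟩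
    scale c (scale a q) +P scale c (0# ∷ (p *P q))
      ≈⟨ scale-distrib-+P c (scale a q) _ ⟨
    scale c (scale a q +P (0# ∷ (p *P q)))
      ∎
    where open ≃-Reasoning

  const-*P : ∀ c p → const c *P p ≃ scale c p
  const-*P c p = ≃-trans (+P-congˡ (scale c p) (0∷-zero ≃-refl)) (+P-identityʳ (scale c p))

  *P-distribʳ : ∀ r p q → (p +P q) *P r ≃ p *P r +P q *P r
  *P-distribʳ = Consequences.comm∧distrˡ⇒distrʳ ≃-setoid +P-cong *P-comm *P-distribˡ

  0∷-*P : ∀ p q → (0# ∷ p) *P q ≃ 0# ∷ (p *P q)
  0∷-*P p q = +P-cong (scale-zero q refl) ≃-refl

  *P-assoc : ∀ p q r → (p *P q) *P r ≃ p *P (q *P r)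
  *P-assoc []      q r = ≃-refl
  *P-assoc (a ∷ p) q r = begin
    (scale a q +P (0# ∷ (p *P q))) *P r
      ≈⟨ *P-distribʳ r (scale a q) _ ⟩
    scale a q *P r +P (0# ∷ (p *P q)) *P r
      ≈⟨ +P-cong (scale-*P a q r) (0∷-*P (p *P q) r) ⟩
    scale a (q *P r) +P (0# ∷ ((p *P q) *P r))
      ≈⟨ +P-congˡ (scale a (q *P r)) (∷-cong refl (*P-assoc p q r)) ⟩
    scale a (q *P r) +P (0# ∷ (p *P (q *P r)))
      ∎
    where open ≃-Reasoning

  *P-identityˡ : ∀ p → const 1# *P p ≃ p
  *P-identityˡ p = ≃-trans (const-*P 1# p) (scale-identity p)

  Poly-commutativeRing : CommutativeRing 0ℓ 0ℓ
  Poly-commutativeRing = record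
    { Carrier = Poly
    ; _≈_     = _≃_
    ; _+_     = _+P_
    ; _*_     = _*P_
    ; -_      = negP
    ; 0#      = []
    ; 1#      = const 1#
    ; isCommutativeRing = record
      { isRing = record
        { +-isAbelianGroup = record
          { isGroup = record
            { isMonoid = record
              { isSemigroup = record
                { isMagma = record { isEquivalence = Setoid.isEquivalence ≃-setoid ; ∙-cong = +P-cong }
                ; assoc   = +P-assoc
                }
              ; identity = (λ _ → ≃-refl) , +P-identityʳ
              }
            ; inverse = Consequences.comm∧invʳ⇒inv ≃-setoid +P-comm negP-inverseʳ
            ; ⁻¹-cong = scale-cong refl
            }
          ; comm = +P-comm
          }
        ; *-cong     = λ {_} {p′} {q} p≃p′ q≃q′ → ≃-trans (*P-congˡ q p≃p′) (*P-congʳ p′ q≃q′)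
        ; *-assoc    = *P-assoc
        ; *-identity = Consequences.comm∧idˡ⇒id ≃-setoid *P-comm *P-identityˡ
        ; distrib    = *P-distribˡ , *P-distribʳ
        }
      ; *-comm = *P-comm
      }
    }

  X*P : ∀ p → X *P p ≃ 0# ∷ p
  X*P p = ≃-trans (+P-cong (scale-zero p refl) ≃-refl) (∷-cong refl (*P-identityˡ p))

module PolyRing (F : CDVF) where
  open CommutativeRing (Polynomials.Poly-commutativeRing F) public
  open import Algebra.Properties.Ring ring public
  open import Algebra.Properties.CommutativeSemigroup *-commutativeSemigroup public

module Degree (F : CDVF) where
  open CDVF F hiding (zero)
  open Over F
  open Polynomials F

  private
    data DegLc (p : Poly) : Maybe (ℕ × Carrier) → Set where
      vanishing : (∀ k → coef p k ≈ 0#) → DegLc p nothing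
      leading   : ∀ e → ¬ coef p e ≈ 0# → (∀ k → e < k → coef p k ≈ 0#) →
                  DegLc p (just (e , coef p e))

    isZero?-spec : ∀ a → (isZero? a ≡ true × a ≈ 0#) ⊎ (isZero? a ≡ false × ¬ a ≈ 0#)
    isZero?-spec a with vK a in vKa
    ... | ∞     = inj₁ (≡.refl , vK-∞ a vKa)
    ... | fin _ = inj₂ (≡.refl , λ a≈0 → fin≢∞ (≡.trans (≡.sym vKa) (≡.trans (vK-cong a≈0) vK-0)))
      where fin≢∞ : ∀ {q} → fin q ≢ ∞
            fin≢∞ ()

    degLc-spec : ∀ p → DegLc p (degLc p)
    degLc-spec []      = vanishing λ _ → refl
    degLc-spec (a ∷ p) with degLc p | degLc-spec p
    ... | just _ | leading e lc≉0 above = leading (suc e) lc≉0 λ { (suc k) (s≤s e<k) → above k e<k }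
    ... | nothing | vanishing p≈0 with isZero? a | isZero?-spec a
    ...   | true  | inj₁ (_ , a≈0) = vanishing λ { zero → a≈0 ; (suc k) → p≈0 k }
    ...   | false | inj₂ (_ , a≉0) = leading 0 a≉0 λ { (suc k) _ → p≈0 k }

  data DegreeView (p : Poly) : Set where
    vanishing : deg p ≡ 0 → lc p ≡ 0# → (∀ k → coef p k ≈ 0#) → DegreeView p
    leading   : coef p (deg p) ≡ lc p → ¬ lc p ≈ 0# → (∀ k → deg p < k → coef p k ≈ 0#) →
                DegreeView p

  private
    deg-lc-just : ∀ p {e c} → degLc p ≡ just (e , c) → deg p ≡ e × lc p ≡ c
    deg-lc-just p eq with degLc p
    deg-lc-just p ≡.refl | just _ = ≡.refl , ≡.refl

    deg-lc-nothing : ∀ p → degLc p ≡ nothing → deg p ≡ 0 × lc p ≡ 0#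
    deg-lc-nothing p eq with degLc p
    deg-lc-nothing p ≡.refl | nothing = ≡.refl , ≡.refl

  degreeView : ∀ p → DegreeView p
  degreeView p with degLc p in eq | degLc-spec p
  ... | _ | vanishing p≈0 = vanishing (proj₁ (deg-lc-nothing p eq)) (proj₂ (deg-lc-nothing p eq)) p≈0
  ... | _ | leading e lc≉0 above with deg-lc-just p eq
  ...   | ≡.refl , lc≡ = leading (≡.sym lc≡) (λ lc≈0 → lc≉0 (≡.subst (_≈ 0#) lc≡ lc≈0)) above

  VanishesFrom : ℕ → Poly → Set
  VanishesFrom d p = ∀ k → d ≤ k → coef p k ≈ 0#

  monic-coef : ∀ φ → Monic φ → coef φ (deg φ) ≈ 1# × VanishesFrom (suc (deg φ)) φ
  monic-coef φ lc≈1 with degreeView φ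
  ... | vanishing _ lc≡0 _ = ⊥-elim (0≉1 (≡.subst (_≈ 1#) lc≡0 lc≈1))
  ... | leading top≡lc _ above = ≡.subst (_≈ 1#) (≡.sym top≡lc) lc≈1 , above

  vanishesFrom⇒deg< : ∀ {d} p → 0 < d → VanishesFrom d p → deg p < d
  vanishesFrom⇒deg< {d} p 0<d p≈0 with degreeView p
  ... | vanishing deg≡0 _ _ = ≡.subst (_< d) (≡.sym deg≡0) 0<d
  ... | leading top≡lc lc≉0 _ with deg p <? d
  ...   | yes deg<d = deg<d
  ...   | no  deg≮d = ⊥-elim (lc≉0 (≡.subst (_≈ 0#) top≡lc (p≈0 (deg p) (ℕ.≮⇒≥ deg≮d))))

  deg-const : ∀ c → deg (const c) ≡ 0
  deg-const c = ℕ.n<1⇒n≡0 (vanishesFrom⇒deg< (const c) (s≤s z≤n) λ { (suc k) _ → refl })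

module _ (F : CDVF) where
  open Over F

  -- Horner's scheme: X·b = xRem b + (top b)·φ with deg (xRem b) < deg φ whenever deg b < deg φ,
  -- so an expansion of X·f is obtained from one of f by a carry from each digit to the next.
  module Expansion (φ : Poly) (φ-monic : Monic φ) (0<deg-φ : 0 < deg φ) where
    open CDVF F hiding (zero)
    open Polynomials F
    open Degree F
    open import Algebra.Properties.Ring ring using (-0#≈0#)
    private module K = SetoidReasoning setoid

    d : ℕ
    d = pred (deg φ)

    deg-φ : deg φ ≡ suc d
    deg-φ = ≡.sym (ℕ.suc-pred (deg φ) {{>-nonZero 0<deg-φ}})

    Reduced : Poly → Set
    Reduced = VanishesFrom (suc d)

    top : Poly → Carrier
    top b = coef b d

    xRem : Poly → Poly
    xRem b = X *P b -P scale (top b) φ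

    coef-xRem : ∀ b k → coef (xRem b) (suc k) ≈ coef b k - top b * coef φ (suc k)
    coef-xRem b k = K.begin
      coef (xRem b) (suc k)
        K.≈⟨ coef-+P (X *P b) (negP (scale (top b) φ)) (suc k) ⟩
      coef (X *P b) (suc k) + coef (negP (scale (top b) φ)) (suc k)
        K.≈⟨ +-cong (coef-≈ (X*P b) (suc k)) (coef-negP (scale (top b) φ) (suc k)) ⟩
      coef b k - coef (scale (top b) φ) (suc k)
        K.≈⟨ +-congˡ (-‿cong (coef-scale (top b) φ (suc k))) ⟩
      coef b k - top b * coef φ (suc k)
        K.∎

    xRem-reduced : ∀ b → Reduced b → Reduced (xRem b)
    xRem-reduced b b-reduced (suc k) (s≤s d≤k) with ℕ.m≤n⇒m<n∨m≡n d≤k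
    ... | inj₂ ≡.refl = K.begin
      coef (xRem b) (suc d)             K.≈⟨ coef-xRem b d ⟩
      top b - top b * coef φ (suc d)    K.≈⟨ +-congˡ (-‿cong (trans (*-congˡ φ-lead) (*-identityʳ _))) ⟩
      top b - top b                     K.≈⟨ -‿inverseʳ _ ⟩
      0#                                K.∎
      where
      φ-lead : coef φ (suc d) ≈ 1#
      φ-lead = ≡.subst (λ e → coef φ e ≈ 1#) deg-φ (proj₁ (monic-coef φ φ-monic))
    ... | inj₁ d<k = K.begin
      coef (xRem b) (suc k)             K.≈⟨ coef-xRem b k ⟩
      coef b k - top b * coef φ (suc k)
                                        K.≈⟨ +-cong (b-reduced k d<k) (-‿cong (trans (*-congˡ φ-high) (zeroʳ _))) ⟩
      0# - 0#                           K.≈⟨ trans (+-identityˡ _) -0#≈0# ⟩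
      0#                                K.∎
      where
      φ-high : coef φ (suc k) ≈ 0#
      φ-high = proj₂ (monic-coef φ φ-monic) (suc k)
                 (≡.subst (λ e → suc e ≤ suc k) (≡.sym deg-φ) (s≤s d<k))

    X*P-φ-adic-step : ∀ b B → X *P (b +P φ *P B) ≃ xRem b +P φ *P (const (top b) +P X *P B)
    X*P-φ-adic-step b B = begin
      X *P (b +P φ *P B)                          ≈⟨ P.distribˡ X b (φ *P B) ⟩
      X *P b +P X *P (φ *P B)                     ≈⟨ P.+-congʳ (≃-sym (P.//-rightDividesˡ S (X *P b))) ⟩
      (xRem b +P S) +P X *P (φ *P B)              ≈⟨ P.+-assoc (xRem b) S _ ⟩
      xRem b +P (S +P X *P (φ *P B))              ≈⟨ +P-congˡ (xRem b) (+P-cong S≃φc XφB) ⟩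
      xRem b +P (φ *P c +P φ *P (X *P B))         ≈⟨ P.+-congˡ (P.distribˡ φ c (X *P B)) ⟨
      xRem b +P φ *P (c +P X *P B)                ∎
      where
      open ≃-Reasoning
      module P = PolyRing F
      c S : Poly
      c = const (top b)
      S = scale (top b) φ
      S≃φc : S ≃ φ *P c
      S≃φc = ≃-trans (≃-sym (const-*P (top b) φ)) (*P-comm c φ)
      XφB : X *P (φ *P B) ≃ φ *P (X *P B)
      XφB = P.x∙yz≈y∙xz X φ B

    addConst : Carrier → List Poly → List Poly
    addConst c []       = const c ∷ []
    addConst c (b ∷ bs) = (const c +P b) ∷ bs

    mulX : List Poly → List Poly
    mulX []       = []
    mulX (b ∷ bs) = xRem b ∷ addConst (top b) (mulX bs)

    expand : Poly → List Poly
    expand []      = []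
    expand (a ∷ f) = addConst a (mulX (expand f))

    φsum-addConst : ∀ c bs → φsum φ (addConst c bs) ≃ const c +P φsum φ bs
    φsum-addConst c []       = ≃-trans (+P-congˡ (const c) (*P-zeroʳ φ)) (+P-identityʳ (const c))
    φsum-addConst c (b ∷ bs) = +P-assoc (const c) b _

    φsum-mulX : ∀ bs → φsum φ (mulX bs) ≃ X *P φsum φ bs
    φsum-mulX []       = ≃-sym (*P-zeroʳ X)
    φsum-mulX (b ∷ bs) = begin
      xRem b +P φ *P φsum φ (addConst (top b) (mulX bs))
        ≈⟨ +P-congˡ (xRem b) (*P-congʳ φ (φsum-addConst (top b) (mulX bs))) ⟩
      xRem b +P φ *P (const (top b) +P φsum φ (mulX bs))
        ≈⟨ +P-congˡ (xRem b) (*P-congʳ φ (+P-congˡ (const (top b)) (φsum-mulX bs))) ⟩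
      xRem b +P φ *P (const (top b) +P X *P φsum φ bs)
        ≈⟨ X*P-φ-adic-step b (φsum φ bs) ⟨
      X *P (b +P φ *P φsum φ bs)
        ∎
      where open ≃-Reasoning

    φsum-expand : ∀ f → f ≃ φsum φ (expand f)
    φsum-expand []      = ≃-refl
    φsum-expand (a ∷ f) = begin
      a ∷ f                                   ≈⟨ ∷-cong (sym (+-identityʳ a)) ≃-refl ⟩
      const a +P (0# ∷ f)                     ≈⟨ +P-congˡ (const a) (≃-sym (X*P f)) ⟩
      const a +P X *P f                       ≈⟨ +P-congˡ (const a) (*P-congʳ X (φsum-expand f)) ⟩
      const a +P X *P φsum φ (expand f)       ≈⟨ +P-congˡ (const a) (φsum-mulX (expand f)) ⟨
      const a +P φsum φ (mulX (expand f))     ≈⟨ φsum-addConst a (mulX (expand f)) ⟨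
      φsum φ (expand (a ∷ f))                 ∎
      where open ≃-Reasoning

    const-reduced : ∀ c → Reduced (const c)
    const-reduced c (suc k) _ = refl

    +P-reduced : ∀ p q → Reduced p → Reduced q → Reduced (p +P q)
    +P-reduced p q p-reduced q-reduced k d<k =
      trans (coef-+P p q k) (trans (+-cong (p-reduced k d<k) (q-reduced k d<k)) (+-identityˡ 0#))

    addConst-reduced : ∀ c {bs} → All Reduced bs → All Reduced (addConst c bs)
    addConst-reduced c []                       = const-reduced c ∷ []
    addConst-reduced c {b ∷ _} (b-red ∷ bs-red) = +P-reduced (const c) b (const-reduced c) b-red ∷ bs-red

    mulX-reduced : ∀ {bs} → All Reduced bs → All Reduced (mulX bs)
    mulX-reduced []                       = []
    mulX-reduced {b ∷ _} (b-red ∷ bs-red) = xRem-reduced b b-red ∷ addConst-reduced (top b) (mulX-reduced bs-red)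

    expand-reduced : ∀ f → All Reduced (expand f)
    expand-reduced []      = []
    expand-reduced (a ∷ f) = addConst-reduced a (mulX-reduced (expand-reduced f))

    reduced⇒allDegLt : ∀ {as} → All Reduced as → AllDegLt (deg φ) as
    reduced⇒allDegLt []               = tt
    reduced⇒allDegLt {a ∷ _} (a-red ∷ as-red) =
      ≡.subst (deg a <_) (≡.sym deg-φ) (vanishesFrom⇒deg< a (s≤s z≤n) a-red) , reduced⇒allDegLt as-red

    φ-adic-expansion : ∀ f → ∃[ as ] (AllDegLt (deg φ) as × f ≈P φsum φ as)
    φ-adic-expansion f = expand f , reduced⇒allDegLt (expand-reduced f) , ≃⇒≈P f _ (φsum-expand f)

module PseudoValuations (F : CDVF) where
  open CDVF F hiding (zero)
  open Over F
  open Polynomials F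
  open import Algebra.Properties.Ring ring using (-1*x≈-x; -‿involutive)

  vK-1# : vK 1# ≡ fin 0ℚ
  vK-1# with vK 1# in vK1
  ... | ∞     = ⊥-elim (0≉1 (sym (vK-∞ 1# vK1)))
  ... | fin p = ≡.cong fin (x+x≈x⇒x≈0 p (fin-injective (begin
    fin (p ℚ.+ p)        ≡⟨ ≡.cong₂ _+∞_ vK1 vK1 ⟨
    vK 1# +∞ vK 1#       ≡⟨ vK-* 1# 1# ⟨
    vK (1# * 1#)         ≡⟨ vK-cong (*-identityˡ 1#) ⟩
    vK 1#                ≡⟨ vK1 ⟩
    fin p                ∎)))
    where open ≡.≡-Reasoning

  vK-−1# : vK (- 1#) ≡ fin 0ℚ
  vK-−1# = x+∞x≡0⇒x≡0 (begin
    vK (- 1#) +∞ vK (- 1#)    ≡⟨ vK-* (- 1#) (- 1#) ⟨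
    vK (- 1# * - 1#)          ≡⟨ vK-cong (trans (-1*x≈-x (- 1#)) (-‿involutive 1#)) ⟩
    vK 1#                     ≡⟨ vK-1# ⟩
    fin 0ℚ                    ∎)
    where open ≡.≡-Reasoning

  module _ {z : PV} (z-pv : IsPseudoValuation z) where
    open IsPseudoValuation z-pv

    resp-≃ : ∀ {p q} → p ≃ q → z p ≡ z q
    resp-≃ {p} {q} p≃q = cong (≃⇒≈P p q p≃q)

    value-[] : z [] ≡ ∞
    value-[] = ≡.trans (cong (refl , tt)) (≡.trans (extends 0#) vK-0)

    value-negP : ∀ p → z (negP p) ≡ z p
    value-negP p = begin
      z (negP p)                  ≡⟨ resp-≃ (≃-sym (const-*P (- 1#) p)) ⟩
      z (const (- 1#) *P p)       ≡⟨ mult (const (- 1#)) p ⟩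
      z (const (- 1#)) +∞ z p     ≡⟨ ≡.cong (_+∞ z p) (≡.trans (extends (- 1#)) vK-−1#) ⟩
      fin 0ℚ +∞ z p               ≡⟨ +∞-identityˡ (z p) ⟩
      z p                         ∎
      where open ≡.≡-Reasoning

    value-+P-dominant : ∀ a b → z a <∞ z b → z (a +P b) ≡ z a
    value-+P-dominant a b za<zb = ≤∞-antisym upper lower
      where
      lower : z a ≤∞ z (a +P b)
      lower = ≡.subst (_≤∞ z (a +P b)) (x≤y⇒min∞≡x (<⇒≤∞ za<zb)) (ultra a b)
      a+b-b : min∞ (z (a +P b)) (z b) ≤∞ z a
      a+b-b = ≡.subst₂ (λ x y → min∞ (z (a +P b)) x ≤∞ y)
                (value-negP b) (resp-≃ (PolyRing.//-rightDividesʳ F b a)) (ultra (a +P b) (negP b))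
      upper : z (a +P b) ≤∞ z a
      upper = min∞≤-<⇒≤ a+b-b za<zb

    value-+P : ∀ a b → (z a ≡ z b → z (a +P b) ≤∞ z a) → z (a +P b) ≡ min∞ (z a) (z b)
    value-+P a b tie with <∞-cmp (z a) (z b)
    ... | tri< za<zb _ _ = ≡.trans (value-+P-dominant a b za<zb) (≡.sym (x≤y⇒min∞≡x (<⇒≤∞ za<zb)))
    ... | tri≈ _ za≡zb _ = ≤∞-antisym
      (≡.subst (z (a +P b) ≤∞_) (≡.sym (x≤y⇒min∞≡x (≤∞-reflexive za≡zb))) (tie za≡zb)) (ultra a b)
    ... | tri> _ _ zb<za = begin
      z (a +P b)        ≡⟨ resp-≃ (+P-comm a b) ⟩
      z (b +P a)        ≡⟨ value-+P-dominant b a zb<za ⟩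
      z b               ≡⟨ x≥y⇒min∞≡y (<⇒≤∞ zb<za) ⟨
      min∞ (z a) (z b)  ∎
      where open ≡.≡-Reasoning

module Augmentations (F : CDVF) where
  open CDVF F using (1#; refl)
  open Over F
  open Polynomials F
  open PseudoValuations F
  open Degree F using (deg-const)

  augVal-suc : ∀ u l k as → augVal u l (suc k) as ≡ l +∞ augVal u l k as
  augVal-suc u l k []       = ≡.sym (+∞-zeroʳ l)
  augVal-suc u l k (a ∷ as) = begin
    min∞ (u a +∞ (l +∞ k ·∞ l)) (augVal u l (suc (suc k)) as)
      ≡⟨ ≡.cong₂ min∞ shift (augVal-suc u l (suc k) as) ⟩
    min∞ (l +∞ (u a +∞ k ·∞ l)) (l +∞ augVal u l (suc k) as)
      ≡⟨ +∞-distribˡ-min∞ l _ _ ⟨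
    l +∞ min∞ (u a +∞ k ·∞ l) (augVal u l (suc k) as)
      ∎
    where
    open ≡.≡-Reasoning
    shift : u a +∞ (l +∞ k ·∞ l) ≡ l +∞ (u a +∞ k ·∞ l)
    shift = begin
      u a +∞ (l +∞ k ·∞ l)   ≡⟨ +∞-assoc (u a) l _ ⟨
      (u a +∞ l) +∞ k ·∞ l   ≡⟨ ≡.cong (_+∞ k ·∞ l) (+∞-comm (u a) l) ⟩
      (l +∞ u a) +∞ k ·∞ l   ≡⟨ +∞-assoc l (u a) _ ⟩
      l +∞ (u a +∞ k ·∞ l)   ∎

  augVal-∷ : ∀ u l a as → augVal u l 0 (a ∷ as) ≡ min∞ (u a) (l +∞ augVal u l 0 as)
  augVal-∷ u l a as = ≡.cong₂ min∞ (+∞-identityʳ (u a)) (augVal-suc u l 0 as)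

  augVal-mono : ∀ u {l l′} as → l ≤∞ l′ → augVal u l 0 as ≤∞ augVal u l′ 0 as
  augVal-mono u []       l≤l′ = ≤∞-refl
  augVal-mono u {l} {l′} (a ∷ as) l≤l′ = begin
    augVal u l 0 (a ∷ as)               ≡⟨ augVal-∷ u l a as ⟩
    min∞ (u a) (l +∞ augVal u l 0 as)   ≤⟨ ⊓-mono-≤ (≤∞-refl {u a}) (+∞-mono-≤ l≤l′ (augVal-mono u as l≤l′)) ⟩
    min∞ (u a) (l′ +∞ augVal u l′ 0 as) ≡⟨ augVal-∷ u l′ a as ⟨
    augVal u l′ 0 (a ∷ as)              ∎
    where open ≤∞-Reasoning

  φsum⇒augmentation : ∀ {u φ l w} → IsPseudoValuation w →
    (∀ as → AllDegLt (deg φ) as → w (φsum φ as) ≡ augVal u l 0 as) → IsAugmentation u φ l w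
  φsum⇒augmentation w-pv w-φsum f as small f≈ = ≡.trans (IsPseudoValuation.cong w-pv f≈) (w-φsum as small)

  augVal≤value : ∀ {u z} → IsPseudoValuation z → ∀ φ → (∀ a → deg a < deg φ → u a ≤∞ z a) →
    ∀ as → AllDegLt (deg φ) as → augVal u (z φ) 0 as ≤∞ z (φsum φ as)
  augVal≤value z-pv φ u≤z []       _ = ≤∞-reflexive (≡.sym (value-[] z-pv))
  augVal≤value {u} {z} z-pv φ u≤z (a ∷ as) (a-small , as-small) = begin
    augVal u (z φ) 0 (a ∷ as)                   ≡⟨ augVal-∷ u (z φ) a as ⟩
    min∞ (u a) (z φ +∞ augVal u (z φ) 0 as)
      ≤⟨ ⊓-mono-≤ (u≤z a a-small) (+∞-monoʳ-≤ (z φ) (augVal≤value z-pv φ u≤z as as-small)) ⟩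
    min∞ (z a) (z φ +∞ z g)                     ≡⟨ ≡.cong (min∞ (z a)) (mult φ g) ⟨
    min∞ (z a) (z (φ *P g))                     ≤⟨ ultra a (φ *P g) ⟩
    z (a +P φ *P g)                             ∎
    where
    open IsPseudoValuation z-pv
    open ≤∞-Reasoning
    g : Poly
    g = φsum φ as

  -- In a tie, u(a + φg) > u(a) would say a ∼ᵤ (−g)φ, i.e. φ ∣ᵤ a, contradicting deg a < deg φ.
  key-polynomial-φsum : ∀ {u φ} → IsPseudoValuation u → IsKeyPolynomial u φ →
    ∀ as → AllDegLt (deg φ) as → u (φsum φ as) ≡ augVal u (u φ) 0 as
  key-polynomial-φsum u-pv key []       _ = value-[] u-pv
  key-polynomial-φsum {u} {φ} u-pv key (a ∷ as) (a-small , as-small) = begin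
    u (a +P φ *P g)
      ≡⟨ value-+P u-pv a (φ *P g) (λ _ → ≮⇒≥∞ φ∤a) ⟩
    min∞ (u a) (u (φ *P g))
      ≡⟨ ≡.cong (min∞ (u a)) (mult φ g) ⟩
    min∞ (u a) (u φ +∞ u g)
      ≡⟨ ≡.cong (λ x → min∞ (u a) (u φ +∞ x)) (key-polynomial-φsum u-pv key as as-small) ⟩
    min∞ (u a) (u φ +∞ augVal u (u φ) 0 as)
      ≡⟨ augVal-∷ u (u φ) a as ⟨
    augVal u (u φ) 0 (a ∷ as)
      ∎
    where
    open IsPseudoValuation u-pv
    open IsKeyPolynomial key
    open ≡.≡-Reasoning
    g : Poly
    g = φsum φ as
    −[−gφ]≃φg : negP (negP g *P φ) ≃ φ *P g
    −[−gφ]≃φg = ≃-trans (scale-cong refl (≃-sym (P.-‿distribˡ-* g φ)))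
                  (≃-trans (P.-‿involutive (g *P φ)) (*P-comm g φ))
      where module P = PolyRing F
    φ∤a : ¬ (u a <∞ u (a +P φ *P g))
    φ∤a a∼-gφ = ℕ.<⇒≱ a-small
      (minimal a (negP g , ≡.subst (u a <∞_) (≡.sym (resp-≃ u-pv (+P-congˡ a −[−gφ]≃φg))) a∼-gφ))

  -- In a tie, V(φg) ≥ V(φ) + [u, V(φ)](g) > w(φ) + w(g) = w(a) = V(a), so
  -- w(a + φg) ≤ V(a + φg) = V(a) = w(a).
  squeezed-φsum : ∀ {u w V φ} → IsPseudoValuation w → IsPseudoValuation V →
    u ≤V w → w ≤V V → (∀ a → deg a < deg φ → V a ≡ u a) → w φ <∞ V φ →
    ∀ as → AllDegLt (deg φ) as → w (φsum φ as) ≡ augVal u (w φ) 0 as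
  squeezed-φsum w-pv V-pv u≤w w≤V V≡u wφ<Vφ [] _ = value-[] w-pv
  squeezed-φsum {u} {w} {V} {φ} w-pv V-pv u≤w w≤V V≡u wφ<Vφ (a ∷ as) (a-small , as-small) = value-a+φg
    where
    module W = IsPseudoValuation w-pv
    module V = IsPseudoValuation V-pv
    l U : ℚ∞
    l = w φ
    U = augVal u l 0 as
    g : Poly
    g = φsum φ as
    wa≡ua : w a ≡ u a
    wa≡ua = ≤∞-antisym (≡.subst (w a ≤∞_) (V≡u a a-small) (w≤V a)) (u≤w a)
    Va≡wa : V a ≡ w a
    Va≡wa = ≡.trans (V≡u a a-small) (≡.sym wa≡ua)
    wφg≡l+U : w (φ *P g) ≡ l +∞ U
    wφg≡l+U = ≡.trans (W.mult φ g)
      (≡.cong (l +∞_) (squeezed-φsum w-pv V-pv u≤w w≤V V≡u wφ<Vφ as as-small))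
    U≤Vg : U ≤∞ V g
    U≤Vg = ≤∞-trans (augVal-mono u as (<⇒≤∞ wφ<Vφ))
             (augVal≤value V-pv φ (λ b b-small → ≤∞-reflexive (≡.sym (V≡u b b-small))) as as-small)
    Va<Vφg : ∀ {q} → w a ≡ w (φ *P g) → U ≡ fin q → V a <∞ V (φ *P g)
    Va<Vφg {q} wa≡wφg U≡q = begin-strict
      V a                ≡⟨ ≡.trans Va≡wa (≡.trans wa≡wφg wφg≡l+U) ⟩
      l +∞ U             ≡⟨ ≡.cong (l +∞_) U≡q ⟩
      l +∞ fin q         <⟨ +∞-mono-<-≤ wφ<Vφ (≡.subst (_≤∞ V g) U≡q U≤Vg) ⟩
      V φ +∞ V g         ≡⟨ V.mult φ g ⟨
      V (φ *P g)         ∎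
      where open ≤∞-Reasoning
    tie : w a ≡ w (φ *P g) → w (a +P φ *P g) ≤∞ w a
    tie wa≡wφg with U in U≡
    ... | ∞     = ≡.subst (w (a +P φ *P g) ≤∞_) (≡.sym wa≡∞) (_ ≤∞∞)
      where
      wa≡∞ : w a ≡ ∞
      wa≡∞ = ≡.trans wa≡wφg (≡.trans wφg≡l+U (≡.trans (≡.cong (l +∞_) U≡) (+∞-zeroʳ l)))
    ... | fin q = begin
      w (a +P φ *P g)    ≤⟨ w≤V (a +P φ *P g) ⟩
      V (a +P φ *P g)    ≡⟨ value-+P-dominant V-pv a (φ *P g) (Va<Vφg wa≡wφg U≡) ⟩
      V a                ≡⟨ Va≡wa ⟩
      w a                ∎
      where open ≤∞-Reasoning
    value-a+φg : w (a +P φ *P g) ≡ augVal u l 0 (a ∷ as)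
    value-a+φg = begin
      w (a +P φ *P g)                ≡⟨ value-+P w-pv a (φ *P g) tie ⟩
      min∞ (w a) (w (φ *P g))        ≡⟨ ≡.cong₂ min∞ wa≡ua wφg≡l+U ⟩
      min∞ (u a) (l +∞ U)            ≡⟨ augVal-∷ u l a as ⟨
      augVal u l 0 (a ∷ as)          ∎
      where open ≡.≡-Reasoning

  φsum-[a] : ∀ φ a → φsum φ (a ∷ []) ≃ a
  φsum-[a] φ a = ≃-trans (+P-congˡ a (*P-zeroʳ φ)) (+P-identityʳ a)

  φsum-[0,1] : ∀ φ → φsum φ ([] ∷ const 1# ∷ []) ≃ φ
  φsum-[0,1] φ = begin
    φ *P (const 1# +P φ *P [])   ≈⟨ *P-congʳ φ (φsum-[a] φ (const 1#)) ⟩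
    φ *P const 1#                ≈⟨ *P-comm φ (const 1#) ⟩
    const 1# *P φ                ≈⟨ *P-identityˡ φ ⟩
    φ                            ∎
    where open ≃-Reasoning

  augmentation-below-deg : ∀ {u φ l w} → IsAugmentation u φ l w → ∀ a → deg a < deg φ → w a ≡ u a
  augmentation-below-deg {u} {φ} {l} {w} aug a a-small = begin
    w a                          ≡⟨ aug a (a ∷ []) (a-small , tt) (≃⇒≈P a _ (≃-sym (φsum-[a] φ a))) ⟩
    min∞ (u a +∞ fin 0ℚ) ∞       ≡⟨ min∞-identityʳ _ ⟩
    u a +∞ fin 0ℚ                ≡⟨ +∞-identityʳ (u a) ⟩
    u a                          ∎
    where open ≡.≡-Reasoning

  augmentation-at-key : ∀ {u φ l w} → IsPseudoValuation u → 0 < deg φ → IsAugmentation u φ l w → w φ ≡ l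
  augmentation-at-key {u} {φ} {l} {w} u-pv 0<deg aug = begin
    w φ
      ≡⟨ aug φ ([] ∷ const 1# ∷ []) small (≃⇒≈P φ _ (≃-sym (φsum-[0,1] φ))) ⟩
    augVal u l 0 ([] ∷ const 1# ∷ [])
      ≡⟨ augVal-∷ u l [] (const 1# ∷ []) ⟩
    min∞ (u []) (l +∞ augVal u l 0 (const 1# ∷ []))
      ≡⟨ ≡.cong₂ (λ x y → min∞ x (l +∞ y)) (value-[] u-pv) (augVal-∷ u l (const 1#) []) ⟩
    l +∞ min∞ (u (const 1#)) (l +∞ ∞)
      ≡⟨ ≡.cong₂ (λ x y → l +∞ min∞ x y) (≡.trans (extends 1#) vK-1#) (+∞-zeroʳ l) ⟩
    l +∞ fin 0ℚ
      ≡⟨ +∞-identityʳ l ⟩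
    l
      ∎
    where
    open ≡.≡-Reasoning
    open IsPseudoValuation u-pv using (extends)
    small : AllDegLt (deg φ) ([] ∷ const 1# ∷ [])
    small = 0<deg , ≡.subst (_< deg φ) (≡.sym (deg-const 1#)) 0<deg , tt

  -- A key polynomial may have degree 0 (φ = 1); its only φ-adic expansion is the empty one.
  constant-key-augmentation : ∀ {u φ l w} → deg φ ≡ 0 → IsPseudoValuation w → IsAugmentation u φ l w
  constant-key-augmentation deg≡0 w-pv f []       _             f≈[] =
    ≡.trans (IsPseudoValuation.cong w-pv f≈[]) (value-[] w-pv)
  constant-key-augmentation deg≡0 w-pv f (a ∷ as) (a-small , _) _    with () ← ≡.subst (deg a <_) deg≡0 a-small

  augmentation≤ : ∀ {u φ l v′ w} → IsPseudoValuation w → Monic φ → 0 < deg φ →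
    u ≤V w → l ≤∞ w φ → IsAugmentation u φ l v′ → v′ ≤V w
  augmentation≤ {u} {φ} {l} {v′} {w} w-pv monic 0<deg u≤w l≤wφ aug f
    with Expansion.φ-adic-expansion F φ monic 0<deg f
  ... | as , small , f≈ = begin
    v′ f                  ≡⟨ aug f as small f≈ ⟩
    augVal u l 0 as       ≤⟨ augVal-mono u as l≤wφ ⟩
    augVal u (w φ) 0 as   ≤⟨ augVal≤value w-pv φ (λ a _ → u≤w a) as small ⟩
    w (φsum φ as)         ≡⟨ IsPseudoValuation.cong w-pv f≈ ⟨
    w f                   ∎
    where open ≤∞-Reasoning

  augmentation-unique : ∀ {u φ l w w′} → Monic φ → 0 < deg φ →
    IsAugmentation u φ l w → IsAugmentation u φ l w′ → w ≡V w′
  augmentation-unique {φ = φ} monic 0<deg aug aug′ f with Expansion.φ-adic-expansion F φ monic 0<deg f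
  ... | as , small , f≈ = ≡.trans (aug f as small f≈) (≡.sym (aug′ f as small f≈))

  augmentation-resp-≡V : ∀ {u φ l w w′} → w ≡V w′ → IsAugmentation u φ l w → IsAugmentation u φ l w′
  augmentation-resp-≡V w≡w′ aug f as small f≈ = ≡.trans (≡.sym (w≡w′ f)) (aug f as small f≈)

  key-polynomial-augmentation : ∀ {u φ} → IsPseudoValuation u → IsKeyPolynomial u φ →
    IsAugmentation u φ (u φ) u
  key-polynomial-augmentation u-pv key = φsum⇒augmentation u-pv (key-polynomial-φsum u-pv key)

  squeezed-augmentation : ∀ {u w V φ} → IsPseudoValuation w → IsPseudoValuation V →
    u ≤V w → w ≤V V → (∀ a → deg a < deg φ → V a ≡ u a) → w φ <∞ V φ →
    IsAugmentation u φ (w φ) w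
  squeezed-augmentation w-pv V-pv u≤w w≤V V≡u wφ<Vφ =
    φsum⇒augmentation w-pv (squeezed-φsum w-pv V-pv u≤w w≤V V≡u wφ<Vφ)

consecutive⇒mono-≤ : ∀ {n} (f : Fin n → ℕ) → (∀ i j → toℕ j ≡ suc (toℕ i) → f i < f j) →
  ∀ {i j} → i Fin.≤ j → f i ≤ f j
consecutive⇒mono-≤ {suc n} f f-step {i} = <-weakInduction-startingFrom (λ j → f i ≤ f j) ℕ.≤-refl step
  where
  step : ∀ j → f i ≤ f (inject₁ j) → f i ≤ f (fsuc j)
  step j fi≤fj = ℕ.≤-trans fi≤fj (ℕ.<⇒≤ (f-step (inject₁ j) (fsuc j) (≡.cong suc (≡.sym (toℕ-inject₁ j)))))

consecutive⇒mono-< : ∀ {n} (f : Fin n → ℕ) → (∀ i j → toℕ j ≡ suc (toℕ i) → f i < f j) →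
  ∀ {i j} → i Fin.< j → f i < f j
consecutive⇒mono-< {suc n} f f-step {i} {fsuc j} (s≤s i≤j) =
  ℕ.≤-<-trans (consecutive⇒mono-≤ f f-step (≡.subst (toℕ i ≤_) (≡.sym (toℕ-inject₁ j)) i≤j))
              (f-step (inject₁ j) (fsuc j) (≡.cong suc (≡.sym (toℕ-inject₁ j))))

module _ (F : CDVF) where
  open Over F
  open Augmentations F

  module MinimalChain {n v} (c : Chain n v) (c-minimal : IsMinimalChain c) where

    deg-φs-mono-≤ : ∀ {i j} → i Fin.≤ j → deg (φs c i) ≤ deg (φs c j)
    deg-φs-mono-≤ = consecutive⇒mono-≤ (deg ∘ φs c) c-minimal

    deg-φs-mono-< : ∀ {i j} → i Fin.< j → deg (φs c i) < deg (φs c j)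
    deg-φs-mono-< = consecutive⇒mono-< (deg ∘ φs c) c-minimal

    vs-stable : ∀ j b → (∀ k → j Fin.≤ inject₁ k → deg b < deg (φs c k)) → vs c j b ≡ v b
    vs-stable = >-weakInduction P (λ b _ → end c b) step
      where
      P : Fin (suc n) → Set
      P j = ∀ b → (∀ k → j Fin.≤ inject₁ k → deg b < deg (φs c k)) → vs c j b ≡ v b
      step : ∀ i → P (fsuc i) → P (inject₁ i)
      step i P-suc b b-small = ≡.trans
        (≡.sym (augmentation-below-deg (aug c i) b (b-small i ℕ.≤-refl)))
        (P-suc b λ k i<k → b-small k (ℕ.≤-trans (ℕ.≤-reflexive (toℕ-inject₁ i)) (ℕ.<⇒≤ i<k)))

    value-below-key : ∀ i a → deg a < deg (φs c i) → v a ≡ vs c (inject₁ i) a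
    value-below-key i a a-small = ≡.sym (vs-stable (inject₁ i) a λ k i≤k →
      ℕ.<-≤-trans a-small (deg-φs-mono-≤ (≡.subst₂ _≤_ (toℕ-inject₁ i) (toℕ-inject₁ k) i≤k)))

    value-at-key : ∀ i → 0 < deg (φs c i) → v (φs c i) ≡ λs c i
    value-at-key i 0<deg = ≡.trans
      (≡.sym (vs-stable (fsuc i) (φs c i) λ k i<k →
        deg-φs-mono-< (≡.subst (suc (toℕ i) ≤_) (toℕ-inject₁ k) i<k)))
      (augmentation-at-key (proj₁ (base-valuation c i)) 0<deg (aug c i))

  LiesOnChain : ∀ {n v} → Chain n v → PV → Set
  LiesOnChain c w = ∃[ i ] ∃[ l ]
    ( vs c (inject₁ i) (φs c i) <∞ l
    × l ≤∞ λs c i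
    × IsAugmentation (vs c (inject₁ i)) (φs c i) l w )

  module BelowMinimalChain {n v w} (c : Chain n v) (c-minimal : IsMinimalChain c)
    (v-pv : IsPseudoValuation v) (w-pv : IsPseudoValuation w)
    (v₀≤w : v₀ ≤V w) (v₀≢w : ¬ v₀ ≡V w) (w≤v : w ≤V v) where
    open MinimalChain c c-minimal

    private
      vᵢ-pv : ∀ i → IsPseudoValuation (vs c (inject₁ i))
      vᵢ-pv i = proj₁ (base-valuation c i)

      monic : ∀ i → Monic (φs c i)
      monic i = IsKeyPolynomial.monic (key c i)

    vertex-lies-on-chain : ∀ j → w ≡V vs c j → LiesOnChain c w
    vertex-lies-on-chain fzero    w≡v₀ = ⊥-elim (v₀≢w λ g → ≡.sym (≡.trans (w≡v₀ g) (start c g)))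
    vertex-lies-on-chain (fsuc i) w≡vᵢ₊₁ =
      i , λs c i , λ> c i , ≤∞-refl , augmentation-resp-≡V (λ g → ≡.sym (w≡vᵢ₊₁ g)) (aug c i)

    augmentation-below-key : ∀ i → vs c (inject₁ i) ≤V w → 0 < deg (φs c i) → w (φs c i) <∞ λs c i →
      IsAugmentation (vs c (inject₁ i)) (φs c i) (w (φs c i)) w
    augmentation-below-key i vᵢ≤w 0<deg wφ<λ = squeezed-augmentation w-pv v-pv vᵢ≤w w≤v (value-below-key i)
      (≡.subst (w (φs c i) <∞_) (≡.sym (value-at-key i 0<deg)) wφ<λ)

    lies-on-chain-below-key : ∀ i → vs c (inject₁ i) ≤V w → 0 < deg (φs c i) → w (φs c i) <∞ λs c i →
      LiesOnChain c w
    lies-on-chain-below-key i vᵢ≤w 0<deg wφ<λ with <∞-cmp (vs c (inject₁ i) (φs c i)) (w (φs c i))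
    ... | tri< vᵢφ<wφ _ _ = i , w (φs c i) , vᵢφ<wφ , <⇒≤∞ wφ<λ , augmentation-below-key i vᵢ≤w 0<deg wφ<λ
    ... | tri≈ _ vᵢφ≡wφ _ = vertex-lies-on-chain (inject₁ i)
      (augmentation-unique (monic i) 0<deg (augmentation-below-key i vᵢ≤w 0<deg wφ<λ)
        (≡.subst (λ l → IsAugmentation (vs c (inject₁ i)) (φs c i) l (vs c (inject₁ i))) vᵢφ≡wφ
          (key-polynomial-augmentation (vᵢ-pv i) (key c i))))
    ... | tri> _ _ wφ<vᵢφ = ⊥-elim (≤⇒≯∞ (vᵢ≤w (φs c i)) wφ<vᵢφ)

    on-chain-or-next-below : ∀ i → vs c (inject₁ i) ≤V w → LiesOnChain c w ⊎ vs c (fsuc i) ≤V w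
    on-chain-or-next-below i vᵢ≤w with ℕ.<-cmp 0 (deg (φs c i))
    ... | tri≈ _ 0≡deg _ = inj₁ (i , λs c i , λ> c i , ≤∞-refl , constant-key-augmentation (≡.sym 0≡deg) w-pv)
    ... | tri> _ _ deg<0 = ⊥-elim (ℕ.n≮0 deg<0)
    ... | tri< 0<deg _ _ with <∞-cmp (w (φs c i)) (λs c i)
    ...   | tri< wφ<λ _ _ = inj₁ (lies-on-chain-below-key i vᵢ≤w 0<deg wφ<λ)
    ...   | tri≈ _ wφ≡λ _ = inj₂ (augmentation≤ w-pv (monic i) 0<deg vᵢ≤w (≤∞-reflexive (≡.sym wφ≡λ)) (aug c i))
    ...   | tri> _ _ λ<wφ =
      ⊥-elim (≤⇒≯∞ (≡.subst (w (φs c i) ≤∞_) (value-at-key i 0<deg) (w≤v (φs c i))) λ<wφ)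

    on-chain-or-below : ∀ j → LiesOnChain c w ⊎ vs c j ≤V w
    on-chain-or-below = <-weakInduction (λ j → LiesOnChain c w ⊎ vs c j ≤V w) (inj₂ v₀≤w′)
      λ i → [ inj₁ , on-chain-or-next-below i ]
      where
      v₀≤w′ : vs c fzero ≤V w
      v₀≤w′ g = ≡.subst (_≤∞ w g) (≡.sym (start c g)) (v₀≤w g)

    lies-on-chain : LiesOnChain c w
    lies-on-chain = [ id , end-lies-on-chain ] (on-chain-or-below (fromℕ n))
      where
      end-lies-on-chain : vs c (fromℕ n) ≤V w → LiesOnChain c w
      end-lies-on-chain vₙ≤w = vertex-lies-on-chain (fromℕ n) λ g →
        ≤∞-antisym (≡.subst (w g ≤∞_) (≡.sym (end c g)) (w≤v g)) (vₙ≤w g)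

open Over

proposition2p24 : (F : CDVF) (v w : PV F) →
    IsMacLanePV F v → IsMacLanePV F w →
    _<V_ F (v₀ F) w → _≤V_ F w v →
    (n : ℕ) (c : Chain F n v) → IsMacLaneChain F c → IsMinimalChain F c →
    ∃[ i ] ∃[ l ]
      ( _<∞_ (vs c (inject₁ i) (φs c i)) l
      × l ≤∞ λs c i
      × IsAugmentation F (vs c (inject₁ i)) (φs c i) l w )
proposition2p24 F v w (v-pv , _) (w-pv , _) (v₀≤w , v₀≢w) w≤v n c _ c-minimal =
  BelowMinimalChain.lies-on-chain F c c-minimal v-pv w-pv v₀≤w v₀≢w w≤v
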